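{- Let \[T=\frac{e^y-1-y-y^2/2}{y^3}\in\mathbb{Q}[[y]],\qquad S=S(u,y)=e^{ -y/2}\,y\,u\,\sqrt{1+\frac{2y}{u^2}T},\] where the square root is expanded by the binomial series, so that $S$ is a formal power series in $y$ whose coefficients are Laurent polynomials in $u$. Then for every nonnegative integer $n$, the power series $S(u,y)^n$ contains no even negative powers of $u$ (i.e. for every $j\ge1$, the coefficient of $u^{ -2j}$ in every coefficient of $y^m$ in $S^n$ is zero).
   Context: $S$ is the power series with leading term $yu$ satisfying $1+y+\tfrac12(1-u^2)y^2=e^y(1-S^2/2)$. -}

module Defs where

open import Data.Nat as ℕ using (ℕ; zero; suc)
open import Data.Integer as ℤ using (ℤ; +_; -[1+_]; ∣_∣)
open import Data.Rational as ℚ using (ℚ; 0ℚ; 1ℚ; ½; _/_)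
open import Data.List using (List; []; _∷_; map; replicate; _++_)
open import Data.Bool using (if_then_else_)

-- Laurent polynomials in u over ℚ:  (low , c₀ ∷ c₁ ∷ … ∷ cₖ ∷ [])
-- represents  u^low * (c₀ + c₁ u + … + cₖ u^k).

record Laurent : Set where
  constructor laurent
  field
    low : ℤ
    cs  : List ℚ
open Laurent public

addList : List ℚ → List ℚ → List ℚ
addList [] ys = ys
addList (x ∷ xs) [] = x ∷ xs
addList (x ∷ xs) (y ∷ ys) = (x ℚ.+ y) ∷ addList xs ys

mulList : List ℚ → List ℚ → List ℚ
mulList [] ys = []
mulList (x ∷ xs) ys = addList (map (x ℚ.*_) ys) (0ℚ ∷ mulList xs ys)

pad : ℕ → List ℚ → List ℚ
pad k xs = replicate k 0ℚ ++ xs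

_+L_ : Laurent → Laurent → Laurent
p +L q = laurent l (addList (pad ∣ low p ℤ.- l ∣ (cs p)) (pad ∣ low q ℤ.- l ∣ (cs q)))
  where l = low p ℤ.⊓ low q

_*L_ : Laurent → Laurent → Laurent
p *L q = laurent (low p ℤ.+ low q) (mulList (cs p) (cs q))

mono : ℤ → ℚ → Laurent
mono k c = laurent k (c ∷ [])

0L : Laurent
0L = laurent (+ 0) []

constL : ℚ → Laurent
constL c = mono (+ 0) c

lookupList : ℕ → List ℚ → ℚ
lookupList _ [] = 0ℚ
lookupList zero (x ∷ xs) = x
lookupList (suc n) (x ∷ xs) = lookupList n xs

coeffU : ℤ → Laurent → ℚ
coeffU k p with k ℤ.- low p
... | + n = lookupList n (cs p)
... | -[1+ _ ] = 0ℚ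

-- Formal power series in y with Laurent-polynomial coefficients:
-- f m = coefficient of y^m.

PS : Set
PS = ℕ → Laurent

sumL : ℕ → (ℕ → Laurent) → Laurent
sumL zero f = 0L
sumL (suc n) f = sumL n f +L f n

_*S_ : PS → PS → PS
(f *S g) m = sumL (suc m) (λ i → f i *L g (m ℕ.∸ i))

oneS : PS
oneS zero = constL 1ℚ
oneS (suc m) = 0L

_^S_ : PS → ℕ → PS
f ^S zero = oneS
f ^S suc n = (f ^S n) *S f

constS : Laurent → PS
constS c zero = c
constS c (suc m) = 0L

yS : PS
yS m = if m ℕ.≡ᵇ 1 then constL 1ℚ else 0L

invFact : ℕ → ℚ
invFact zero = 1ℚ
invFact (suc m) = invFact m ℚ.* (+ 1 / suc m)

powQ : ℚ → ℕ → ℚ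
powQ q zero = 1ℚ
powQ q (suc n) = powQ q n ℚ.* q

fallHalf : ℕ → ℚ
fallHalf zero = 1ℚ
fallHalf (suc k) = fallHalf k ℚ.* (½ ℚ.- (+ k / 1))

binomHalf : ℕ → ℚ
binomHalf k = fallHalf k ℚ.* invFact k

expS : ℚ → PS
expS c m = constL (powQ c m ℚ.* invFact m)

-- T = (e^y - 1 - y - y^2/2) / y^3 = Σ_m y^m / (m+3)!
T : PS
T m = constL (invFact (m ℕ.+ 3))

X : PS
X = constS (mono (ℤ.- (+ 2)) (+ 2 / 1)) *S (yS *S T)

-- sqrt(1 + X) by the binomial series Σ_k binom(1/2,k) X^k
-- (well defined since X has zero constant term, so X^k = O(y^k))
sqrt1+ : PS → PS
sqrt1+ Z m = sumL (suc m) (λ k → constL (binomHalf k) *L (Z ^S k) m)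

S : PS
S = (expS (ℚ.- ½) *S (yS *S constS (mono (+ 1) 1ℚ))) *S sqrt1+ X

module Submission where

-- Write S = e^{-y/2} y u Q with Q = √(1 + X) and X = 2yT/u².  The half-binomial
-- coefficients satisfy Σᵢ C(1/2,i) C(1/2,n-i) = [n ≤ 1], so Q² = 1 + X and
-- S² = e^{-y} y² (u² + 2yT): every coefficient of S² is an even polynomial in u.
-- Every coefficient of S involves only odd powers of u.  Hence S^(2k) = (S²)^k has
-- no negative powers of u and S^(2k+1) = (S²)^k S has no even powers of u; either
-- way the coefficient of u^(-2j) vanishes.

open import Defs

open import Algebra.Bundles using (CommutativeSemiring; CommutativeRing)
open import Algebra.Structures.Biased using (isCommutativeSemiringˡ; isCommutativeSemiringʳ; isCommutativeMonoidʳ)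
open import Data.Nat as ℕ using (ℕ; zero; suc; _∸_; _≤_; _<_; z≤n; s≤s; parity)
import Data.Nat.Properties as ℕP
open import Data.Integer as ℤ using (ℤ; +_; -[1+_]; ∣_∣; _⊖_; 0ℤ; 1ℤ)
import Data.Integer.Properties as ℤP
open import Data.Integer.Tactic.RingSolver using (solve-∀)
open import Data.Parity.Base as ℙ using (Parity; 0ℙ; 1ℙ)
import Data.Parity.Properties as ℙP
open import Data.List using (List; []; _∷_; map; length)
open import Data.Rational as ℚ using (ℚ; 0ℚ; 1ℚ; ½)
import Data.Rational.Properties as ℚP
open import Data.Rational.Solver using (module +-*-Solver)
open import Data.Rational.Unnormalised using (mkℚᵘ; *≡*)
import Data.Rational.Unnormalised.Properties as ℚᵘP
open import Data.Sum as Sum using (_⊎_; inj₁; inj₂)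
open import Data.Empty using (⊥-elim)
open import Data.Product using (_,_)
open import Function using (_∘_)
open import Level using (0ℓ)
open import Relation.Binary.PropositionalEquality as ≡ using (_≡_; _≢_)
open import Relation.Nullary using (yes; no)
open import Relation.Unary using (Pred)
open import Relation.Binary.Structures using (IsEquivalence)
import Algebra.Properties.CommutativeSemiring.Exp as Exp
import Algebra.Solver.Ring.NaturalCoefficients.Default as Solver
import Relation.Binary.Reasoning.Setoid as SetoidReasoning

module FiniteSums {c ℓ} (R : CommutativeSemiring c ℓ) where
  open CommutativeSemiring R
  open SetoidReasoning setoid
  open Solver R using (solve; _:=_; _:+_)

  Σ : ℕ → (ℕ → Carrier) → Carrier
  Σ zero    f = 0#
  Σ (suc n) f = Σ n f + f n

  Σ-cong : ∀ n {f g : ℕ → Carrier} → (∀ i → i < n → f i ≈ g i) → Σ n f ≈ Σ n g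
  Σ-cong zero    f≈g = refl
  Σ-cong (suc n) f≈g = +-cong (Σ-cong n (λ i i<n → f≈g i (ℕP.m<n⇒m<1+n i<n))) (f≈g n ℕP.≤-refl)

  Σ-zero : ∀ n {f : ℕ → Carrier} → (∀ i → i < n → f i ≈ 0#) → Σ n f ≈ 0#
  Σ-zero n {f} f≈0 = trans (Σ-cong n f≈0) (lemma n)
    where
    lemma : ∀ n → Σ n (λ _ → 0#) ≈ 0#
    lemma zero    = refl
    lemma (suc n) = trans (+-identityʳ _) (lemma n)

  Σ-distrib-+ : ∀ n (f g : ℕ → Carrier) → Σ n (λ i → f i + g i) ≈ Σ n f + Σ n g
  Σ-distrib-+ zero    f g = sym (+-identityˡ 0#)
  Σ-distrib-+ (suc n) f g = trans (+-cong (Σ-distrib-+ n f g) refl) (interchange _ _ _ _)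
    where
    interchange : ∀ a b c d → (a + b) + (c + d) ≈ (a + c) + (b + d)
    interchange = solve 4 (λ a b c d → (a :+ b) :+ (c :+ d) := (a :+ c) :+ (b :+ d)) refl

  *-distribˡ-Σ : ∀ n a (f : ℕ → Carrier) → a * Σ n f ≈ Σ n (λ i → a * f i)
  *-distribˡ-Σ zero    a f = zeroʳ a
  *-distribˡ-Σ (suc n) a f = trans (distribˡ a _ _) (+-cong (*-distribˡ-Σ n a f) refl)

  *-distribʳ-Σ : ∀ n a (f : ℕ → Carrier) → Σ n f * a ≈ Σ n (λ i → f i * a)
  *-distribʳ-Σ zero    a f = zeroˡ a
  *-distribʳ-Σ (suc n) a f = trans (distribʳ a _ _) (+-cong (*-distribʳ-Σ n a f) refl)

  Σ-head : ∀ n (f : ℕ → Carrier) → Σ (suc n) f ≈ f 0 + Σ n (λ i → f (suc i))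
  Σ-head zero    f = +-comm 0# (f 0)
  Σ-head (suc n) f = trans (+-cong (Σ-head n f) refl) (+-assoc _ _ _)

  Σ-reverse : ∀ n (f : ℕ → Carrier) → Σ n f ≈ Σ n (λ i → f (n ∸ suc i))
  Σ-reverse zero    f = refl
  Σ-reverse (suc n) f = begin
    Σ n f + f n                        ≈⟨ +-cong (Σ-reverse n f) refl ⟩
    Σ n (λ i → f (n ∸ suc i)) + f n    ≈⟨ +-comm _ _ ⟩
    f n + Σ n (λ i → f (n ∸ suc i))    ≈⟨ Σ-head n (λ i → f (n ∸ i)) ⟨
    Σ (suc n) (λ i → f (suc n ∸ suc i)) ∎

  Σ-comm : ∀ n m (f : ℕ → ℕ → Carrier) → Σ n (λ i → Σ m (f i)) ≈ Σ m (λ j → Σ n (λ i → f i j))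
  Σ-comm zero    m f = sym (Σ-zero m (λ _ _ → refl))
  Σ-comm (suc n) m f = trans (+-cong (Σ-comm n m f) refl) (sym (Σ-distrib-+ m _ _))

  Σ-extend : ∀ n m {f : ℕ → Carrier} → n ≤ m → (∀ i → n ≤ i → i < m → f i ≈ 0#) → Σ m f ≈ Σ n f
  Σ-extend n zero    z≤n   _   = refl
  Σ-extend n (suc m) n≤1+m f≈0 with ℕP.m≤n⇒m<n∨m≡n n≤1+m
  ... | inj₂ ≡.refl     = refl
  ... | inj₁ (s≤s n≤m) =
    trans (+-cong (Σ-extend n m n≤m (λ i n≤i i<m → f≈0 i n≤i (ℕP.m<n⇒m<1+n i<m)))
                  (f≈0 m n≤m ℕP.≤-refl))
          (+-identityʳ _)

  Σ-triangle : ∀ n (F : ℕ → ℕ → Carrier) →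
               Σ n (λ s → Σ (suc s) (λ k → F k (s ∸ k))) ≈ Σ n (λ k → Σ (n ∸ k) (F k))
  Σ-triangle zero    F = refl
  Σ-triangle (suc n) F = begin
    Σ n (λ s → Σ (suc s) (λ k → F k (s ∸ k))) + (Σ n diagonal + diagonal n)
      ≈⟨ +-cong (Σ-triangle n F) refl ⟩
    Σ n (λ k → Σ (n ∸ k) (F k)) + (Σ n diagonal + diagonal n)
      ≈⟨ +-assoc _ _ _ ⟨
    (Σ n (λ k → Σ (n ∸ k) (F k)) + Σ n diagonal) + diagonal n
      ≈⟨ +-cong (Σ-distrib-+ n _ _) refl ⟨
    Σ n (λ k → Σ (n ∸ k) (F k) + diagonal k) + diagonal n
      ≈⟨ +-cong (Σ-cong n (λ k k<n → grow k (ℕP.<⇒≤ k<n))) last ⟩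
    Σ n (λ k → Σ (suc n ∸ k) (F k)) + Σ (suc n ∸ n) (F n) ∎
    where
    diagonal : ℕ → Carrier
    diagonal k = F k (n ∸ k)
    grow : ∀ k → k ≤ n → Σ (n ∸ k) (F k) + diagonal k ≈ Σ (suc n ∸ k) (F k)
    grow k k≤n rewrite ℕP.+-∸-assoc 1 k≤n = refl
    last : diagonal n ≈ Σ (suc n ∸ n) (F n)
    last rewrite ℕP.+-∸-assoc 1 (ℕP.≤-refl {n}) | ℕP.n∸n≡0 n = sym (+-identityˡ _)

module PowerSeries {c ℓ} (R : CommutativeSemiring c ℓ) where
  open CommutativeSemiring R
  open FiniteSums R
  open SetoidReasoning setoid
  open Solver R using (solve; _:=_; _:+_; _:*_)

  Series : Set c
  Series = ℕ → Carrier

  infix  4 _≋_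
  infixl 6 _⊕_
  infixl 7 _⊛_

  _≋_ : Series → Series → Set ℓ
  f ≋ g = ∀ n → f n ≈ g n

  _⊕_ : Series → Series → Series
  (f ⊕ g) n = f n + g n

  _⊛_ : Series → Series → Series
  (f ⊛ g) n = Σ (suc n) (λ i → f i * g (n ∸ i))

  constant : Carrier → Series
  constant a zero    = a
  constant a (suc _) = 0#

  0ₛ 1ₛ : Series
  0ₛ _ = 0#
  1ₛ   = constant 1#

  tail : Series → Series
  tail f n = f (suc n)

  ⊛-cong : ∀ {f f′ g g′} → f ≋ f′ → g ≋ g′ → f ⊛ g ≋ f′ ⊛ g′
  ⊛-cong f≋f′ g≋g′ n = Σ-cong (suc n) (λ i _ → *-cong (f≋f′ i) (g≋g′ (n ∸ i)))

  ⊛-comm : ∀ f g → f ⊛ g ≋ g ⊛ f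
  ⊛-comm f g n = trans (Σ-reverse (suc n) _) (Σ-cong (suc n) (λ i i<1+n → swap i (ℕP.≤-pred i<1+n)))
    where
    swap : ∀ i → i ≤ n → f (n ∸ i) * g (n ∸ (n ∸ i)) ≈ g i * f (n ∸ i)
    swap i i≤n rewrite ℕP.m∸[m∸n]≡n i≤n = *-comm _ _

  ⊛-suc : ∀ f g n → (f ⊛ g) (suc n) ≈ f 0 * g (suc n) + (tail f ⊛ g) n
  ⊛-suc f g n = Σ-head (suc n) _

  ⊛-distribʳ-⊕ : ∀ f g h → (f ⊕ g) ⊛ h ≋ f ⊛ h ⊕ g ⊛ h
  ⊛-distribʳ-⊕ f g h n = trans (Σ-cong (suc n) (λ i _ → distribʳ _ _ _)) (Σ-distrib-+ (suc n) _ _)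

  ⊛-scaleˡ : ∀ a f g → (λ i → a * f i) ⊛ g ≋ (λ n → a * (f ⊛ g) n)
  ⊛-scaleˡ a f g n = trans (Σ-cong (suc n) (λ i _ → *-assoc _ _ _)) (sym (*-distribˡ-Σ (suc n) a _))

  ⊛-assoc : ∀ f g h → (f ⊛ g) ⊛ h ≋ f ⊛ (g ⊛ h)
  ⊛-assoc f g h zero    = +-cong refl (trans (*-cong (+-identityˡ _) refl)
                            (trans (*-assoc _ _ _) (*-cong refl (sym (+-identityˡ _)))))
  ⊛-assoc f g h (suc n) = begin
    ((f ⊛ g) ⊛ h) (suc n)
      ≈⟨ ⊛-suc (f ⊛ g) h n ⟩
    (f ⊛ g) 0 * h (suc n) + (tail (f ⊛ g) ⊛ h) n
      ≈⟨ +-cong (*-cong (+-identityˡ _) refl) (⊛-cong {g = h} (⊛-suc f g) (λ _ → refl) n) ⟩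
    (f 0 * g 0) * h (suc n) + (((λ i → f 0 * tail g i) ⊕ tail f ⊛ g) ⊛ h) n
      ≈⟨ +-cong refl (trans (⊛-distribʳ-⊕ _ _ h n) (+-cong (⊛-scaleˡ (f 0) (tail g) h n) (⊛-assoc (tail f) g h n))) ⟩
    (f 0 * g 0) * h (suc n) + (f 0 * (tail g ⊛ h) n + (tail f ⊛ (g ⊛ h)) n)
      ≈⟨ regroup _ _ _ _ _ ⟩
    f 0 * (g 0 * h (suc n) + (tail g ⊛ h) n) + (tail f ⊛ (g ⊛ h)) n
      ≈⟨ +-cong (*-cong refl (⊛-suc g h n)) refl ⟨
    f 0 * (g ⊛ h) (suc n) + (tail f ⊛ (g ⊛ h)) n
      ≈⟨ ⊛-suc f (g ⊛ h) n ⟨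
    (f ⊛ (g ⊛ h)) (suc n) ∎
    where
    regroup : ∀ a b c d e → (a * b) * c + (a * d + e) ≈ a * (b * c + d) + e
    regroup = solve 5 (λ a b c d e → (a :* b) :* c :+ (a :* d :+ e) := a :* (b :* c :+ d) :+ e) refl

  ⊛-identityˡ : ∀ f → 1ₛ ⊛ f ≋ f
  ⊛-identityˡ f n = trans (Σ-head n _) (trans (+-cong (*-identityˡ _) (Σ-zero n (λ i _ → zeroˡ _))) (+-identityʳ _))

  ⊛-zeroˡ : ∀ f → 0ₛ ⊛ f ≋ 0ₛ
  ⊛-zeroˡ f n = Σ-zero (suc n) (λ i _ → zeroˡ _)

  ⊕-⊛-commutativeSemiring : CommutativeSemiring c ℓ
  ⊕-⊛-commutativeSemiring = record
    { Carrier = Series ; _≈_ = _≋_ ; _+_ = _⊕_ ; _*_ = _⊛_ ; 0# = 0ₛ ; 1# = 1ₛ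
    ; isCommutativeSemiring = isCommutativeSemiringˡ record
      { +-isCommutativeMonoid = record
        { isMonoid = record
          { isSemigroup = record
            { isMagma = record { isEquivalence = ≋-isEquivalence ; ∙-cong = λ p q n → +-cong (p n) (q n) }
            ; assoc = λ f g h n → +-assoc _ _ _ }
          ; identity = (λ f n → +-identityˡ _) , (λ f n → +-identityʳ _) }
        ; comm = λ f g n → +-comm _ _ }
      ; *-isCommutativeMonoid = record
        { isMonoid = record
          { isSemigroup = record
            { isMagma = record { isEquivalence = ≋-isEquivalence ; ∙-cong = ⊛-cong }
            ; assoc = ⊛-assoc }
          ; identity = ⊛-identityˡ , (λ f n → trans (⊛-comm f 1ₛ n) (⊛-identityˡ f n)) }
        ; comm = ⊛-comm }
      ; distribʳ = λ h f g → ⊛-distribʳ-⊕ f g h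
      ; zeroˡ = ⊛-zeroˡ
      }
    }
    where
    ≋-isEquivalence : IsEquivalence _≋_
    ≋-isEquivalence = record
      { refl = λ n → refl ; sym = λ p n → sym (p n) ; trans = λ p q n → trans (p n) (q n) }

  open Exp ⊕-⊛-commutativeSemiring public using (_^_; ^-congˡ; ^-homo-*)

  constant-* : ∀ a b → constant a ⊛ constant b ≋ constant (a * b)
  constant-* a b zero    = +-identityˡ _
  constant-* a b (suc n) =
    trans (Σ-head (suc n) _) (trans (+-cong (zeroʳ a) (Σ-zero (suc n) (λ i _ → zeroˡ _))) (+-identityˡ 0#))

  ^-vanishes-below : ∀ X → X 0 ≈ 0# → ∀ k m → m < k → (X ^ k) m ≈ 0#
  ^-vanishes-below X X₀≈0 (suc k) m m<1+k =
    trans (⊛-comm X (X ^ k) m) (Σ-zero (suc m) vanishes)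
    where
    vanishes : ∀ i → i < suc m → (X ^ k) i * X (m ∸ i) ≈ 0#
    vanishes i _ with i ℕP.<? k
    ... | yes i<k = trans (*-cong (^-vanishes-below X X₀≈0 k i i<k) refl) (zeroˡ _)
    ... | no  i≮k = trans (*-cong refl (trans (reflexive (≡.cong X m∸i≡0)) X₀≈0)) (zeroʳ _)
      where
      m∸i≡0 : m ∸ i ≡ 0
      m∸i≡0 = ℕP.m≤n⇒m∸n≡0 (ℕP.≤-trans (ℕP.≤-pred m<1+k) (ℕP.≮⇒≥ i≮k))

  -- Σₖ βₖ Xᵏ, truncated at k ≤ m in degree m; the truncation is exact only when X 0 ≈ 0.
  substitute : Series → Series → Series
  substitute β X m = Σ (suc m) (λ k → β k * (X ^ k) m)

  substitute-cong : ∀ {β β′ X X′} → β ≋ β′ → X ≋ X′ → substitute β X ≋ substitute β′ X′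
  substitute-cong β≋β′ X≋X′ m = Σ-cong (suc m) (λ k _ → *-cong (β≋β′ k) (^-congˡ k X≋X′ m))

  substitute-extend : ∀ β X → X 0 ≈ 0# → ∀ m N → m < N → substitute β X m ≈ Σ N (λ k → β k * (X ^ k) m)
  substitute-extend β X X₀≈0 m N m<N = sym (Σ-extend (suc m) N m<N
    (λ k m<k _ → trans (*-cong refl (^-vanishes-below X X₀≈0 k m m<k)) (zeroʳ _)))

  substitute-⊛ : ∀ β γ X → X 0 ≈ 0# → substitute β X ⊛ substitute γ X ≋ substitute (β ⊛ γ) X
  substitute-⊛ β γ X X₀≈0 m = begin
    Σ M (λ i → substitute β X i * substitute γ X (m ∸ i))
      ≈⟨ Σ-cong M (λ i i<M → *-cong (substitute-extend β X X₀≈0 i M i<M)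
                                     (substitute-extend γ X X₀≈0 (m ∸ i) M (s≤s (ℕP.m∸n≤m m i)))) ⟩
    Σ M (λ i → Σ M (λ k → β k * P k i) * Σ M (λ l → γ l * P l (m ∸ i)))
      ≈⟨ Σ-cong M (λ i _ → trans (*-distribʳ-Σ M _ _) (Σ-cong M (λ k _ → *-distribˡ-Σ M _ _))) ⟩
    Σ M (λ i → Σ M (λ k → Σ M (λ l → (β k * P k i) * (γ l * P l (m ∸ i)))))
      ≈⟨ trans (Σ-comm M M _) (Σ-cong M (λ k _ → Σ-comm M M _)) ⟩
    Σ M (λ k → Σ M (λ l → Σ M (λ i → (β k * P k i) * (γ l * P l (m ∸ i)))))
      ≈⟨ Σ-cong M (λ k _ → Σ-cong M (λ l _ →
           trans (Σ-cong M (λ i _ → interchange _ _ _ _)) (sym (*-distribˡ-Σ M _ _)))) ⟩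
    Σ M (λ k → Σ M (λ l → (β k * γ l) * (P k ⊛ P l) m))
      ≈⟨ Σ-cong M (λ k _ → Σ-cong M (λ l _ → *-cong refl (sym (^-homo-* X k l m)))) ⟩
    Σ M (λ k → Σ M (F k))
      ≈⟨ Σ-cong M (λ k k<M → Σ-extend (M ∸ k) M (ℕP.m∸n≤m M k) (λ l M∸k≤l _ → F-vanishes k l k<M M∸k≤l)) ⟩
    Σ M (λ k → Σ (M ∸ k) (F k))
      ≈⟨ Σ-triangle M F ⟨
    Σ M (λ s → Σ (suc s) (λ k → F k (s ∸ k)))
      ≈⟨ Σ-cong M (λ s _ → trans (Σ-cong (suc s) (λ k k<1+s → F-diagonal s k (ℕP.≤-pred k<1+s)))
                                 (sym (*-distribʳ-Σ (suc s) _ _))) ⟩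
    substitute (β ⊛ γ) X m ∎
    where
    M = suc m
    P = X ^_
    F : ℕ → ℕ → Carrier
    F k l = (β k * γ l) * P (k ℕ.+ l) m
    interchange : ∀ a b c d → (a * b) * (c * d) ≈ (a * c) * (b * d)
    interchange = solve 4 (λ a b c d → (a :* b) :* (c :* d) := (a :* c) :* (b :* d)) refl
    F-vanishes : ∀ k l → k < M → M ∸ k ≤ l → F k l ≈ 0#
    F-vanishes k l k<M M∸k≤l = trans (*-cong refl (^-vanishes-below X X₀≈0 (k ℕ.+ l) m
      (ℕP.≤-trans (ℕP.≤-reflexive (≡.sym (ℕP.m+[n∸m]≡n (ℕP.<⇒≤ k<M)))) (ℕP.+-monoʳ-≤ k M∸k≤l)))) (zeroʳ _)
    F-diagonal : ∀ s k → k ≤ s → F k (s ∸ k) ≈ (β k * γ (s ∸ k)) * P s m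
    F-diagonal s k k≤s rewrite ℕP.m+[n∸m]≡n k≤s = refl

  1+y : Series
  1+y zero          = 1#
  1+y (suc zero)    = 1#
  1+y (suc (suc _)) = 0#

  substitute-1+y : ∀ X → X 0 ≈ 0# → substitute 1+y X ≋ 1ₛ ⊕ X
  substitute-1+y X X₀≈0 zero    =
    trans (+-identityˡ _) (trans (*-identityˡ _) (sym (trans (+-cong refl X₀≈0) (+-identityʳ _))))
  substitute-1+y X X₀≈0 (suc m) = begin
    substitute 1+y X (suc m)
      ≈⟨ trans (Σ-head (suc m) _) (+-cong refl (Σ-head m _)) ⟩
    1# * 0# + (1# * (X ⊛ 1ₛ) (suc m) + Σ m (λ k → 0# * (X ^ suc (suc k)) (suc m)))
      ≈⟨ +-cong (zeroʳ _) (+-cong (trans (*-identityˡ _) (trans (⊛-comm X 1ₛ (suc m)) (⊛-identityˡ X (suc m))))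
                                  (Σ-zero m (λ _ _ → zeroˡ _))) ⟩
    0# + (X (suc m) + 0#)
      ≈⟨ +-cong refl (+-identityʳ _) ⟩
    0# + X (suc m) ∎

  Coeffwise : ∀ {p} → Pred Carrier p → Pred Series p
  Coeffwise P f = ∀ n → P (f n)

  module Closure {p} (P : Pred Carrier p) (P-0# : P 0#) (P-+ : ∀ {a b} → P a → P b → P (a + b)) where

    Σ-preserves : ∀ n {f} → (∀ i → P (f i)) → P (Σ n f)
    Σ-preserves zero    Pf = P-0#
    Σ-preserves (suc n) Pf = P-+ (Σ-preserves n Pf) (Pf n)

    constant-preserves : ∀ {a} → P a → Coeffwise P (constant a)
    constant-preserves Pa zero    = Pa
    constant-preserves Pa (suc _) = P-0#

    ⊕-preserves : ∀ {f g} → Coeffwise P f → Coeffwise P g → Coeffwise P (f ⊕ g)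
    ⊕-preserves Pf Pg n = P-+ (Pf n) (Pg n)

    ⊛-preserves : ∀ {p₁ p₂} {P₁ : Pred Carrier p₁} {P₂ : Pred Carrier p₂} →
                  (∀ {a b} → P₁ a → P₂ b → P (a * b)) →
                  ∀ {f g} → Coeffwise P₁ f → Coeffwise P₂ g → Coeffwise P (f ⊛ g)
    ⊛-preserves P-* Pf Pg n = Σ-preserves (suc n) (λ i → P-* (Pf i) (Pg (n ∸ i)))

    module _ (P-1# : P 1#) (P-* : ∀ {a b} → P a → P b → P (a * b)) where

      ^-preserves : ∀ {f} → Coeffwise P f → ∀ k → Coeffwise P (f ^ k)
      ^-preserves Pf zero    = constant-preserves P-1#
      ^-preserves Pf (suc k) = ⊛-preserves P-* Pf (^-preserves Pf k)

      substitute-preserves : ∀ {β X} → Coeffwise P β → Coeffwise P X → Coeffwise P (substitute β X)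
      substitute-preserves Pβ PX m = Σ-preserves (suc m) (λ k → P-* (Pβ k) (^-preserves PX k m))

-- Stated over an arbitrary commutative semiring because the ring solver is far too slow
-- when run directly on the semiring of Laurent-coefficient power series.
module Rearrangements {c ℓ} (R : CommutativeSemiring c ℓ) where
  open CommutativeSemiring R
  open Solver R using (solve; _:=_; _:+_; _:*_; con)

  square-of-product : ∀ e y v q → ((e * (y * v)) * q) * ((e * (y * v)) * q) ≈ (((e * e) * (y * y)) * (v * v)) * (q * q)
  square-of-product = solve 4 (λ e y v q →
    ((e :* (y :* v)) :* q) :* ((e :* (y :* v)) :* q) := (((e :* e) :* (y :* y)) :* (v :* v)) :* (q :* q)) refl

  distribute : ∀ b v c t → (b * (v * v)) * (1# + c * t) ≈ b * (v * v + ((v * v) * c) * t)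
  distribute = solve 4 (λ b v c t → (b :* (v :* v)) :* (con 1 :+ c :* t) := b :* (v :* v :+ ((v :* v) :* c) :* t)) refl

open ≡ using (refl; cong; cong₂)

ℚ-commutativeSemiring : CommutativeSemiring _ _
ℚ-commutativeSemiring = CommutativeRing.commutativeSemiring ℚP.+-*-commutativeRing

module ℚ[[y]] = PowerSeries ℚ-commutativeSemiring
module ℚΣ = FiniteSums ℚ-commutativeSemiring
open ℚΣ using (Σ)

module ListCoefficients where
  open ≡.≡-Reasoning

  lookupList-[] : ∀ n → lookupList n [] ≡ 0ℚ
  lookupList-[] zero    = refl
  lookupList-[] (suc n) = refl

  lookupList-addList : ∀ n xs ys → lookupList n (addList xs ys) ≡ lookupList n xs ℚ.+ lookupList n ys
  lookupList-addList n       []       ys       = ≡.sym (ℚP.+-identityˡ _)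
  lookupList-addList n       (x ∷ xs) []       = ≡.sym (ℚP.+-identityʳ _)
  lookupList-addList zero    (x ∷ xs) (y ∷ ys) = refl
  lookupList-addList (suc n) (x ∷ xs) (y ∷ ys) = lookupList-addList n xs ys

  lookupList-map-* : ∀ n c ys → lookupList n (map (c ℚ.*_) ys) ≡ c ℚ.* lookupList n ys
  lookupList-map-* n       c []       = ≡.sym (ℚP.*-zeroʳ c)
  lookupList-map-* zero    c (y ∷ ys) = refl
  lookupList-map-* (suc n) c (y ∷ ys) = lookupList-map-* n c ys

  toSeries : List ℚ → ℚ[[y]].Series
  toSeries xs n = lookupList n xs

  lookupList-mulList : ∀ n xs ys → lookupList n (mulList xs ys) ≡ ℚ[[y]]._⊛_ (toSeries xs) (toSeries ys) n
  lookupList-mulList n       []       ys = ≡.sym (ℚ[[y]].⊛-zeroˡ (toSeries ys) n)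
  lookupList-mulList zero    (x ∷ xs) ys = begin
    lookupList 0 (addList (map (x ℚ.*_) ys) (0ℚ ∷ mulList xs ys)) ≡⟨ lookupList-addList 0 (map (x ℚ.*_) ys) _ ⟩
    lookupList 0 (map (x ℚ.*_) ys) ℚ.+ 0ℚ                          ≡⟨ ℚP.+-identityʳ _ ⟩
    lookupList 0 (map (x ℚ.*_) ys)                                 ≡⟨ lookupList-map-* 0 x ys ⟩
    x ℚ.* lookupList 0 ys                                          ≡⟨ ℚP.+-identityˡ _ ⟨
    ℚ[[y]]._⊛_ (toSeries (x ∷ xs)) (toSeries ys) 0 ∎
  lookupList-mulList (suc n) (x ∷ xs) ys = begin
    lookupList (suc n) (addList (map (x ℚ.*_) ys) (0ℚ ∷ mulList xs ys))
      ≡⟨ lookupList-addList (suc n) (map (x ℚ.*_) ys) _ ⟩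
    lookupList (suc n) (map (x ℚ.*_) ys) ℚ.+ lookupList n (mulList xs ys)
      ≡⟨ cong₂ ℚ._+_ (lookupList-map-* (suc n) x ys) (lookupList-mulList n xs ys) ⟩
    x ℚ.* lookupList (suc n) ys ℚ.+ ℚ[[y]]._⊛_ (toSeries xs) (toSeries ys) n
      ≡⟨ ℚ[[y]].⊛-suc (toSeries (x ∷ xs)) (toSeries ys) n ⟨
    ℚ[[y]]._⊛_ (toSeries (x ∷ xs)) (toSeries ys) (suc n) ∎

  lookupℤ : ℤ → List ℚ → ℚ
  lookupℤ (+ n)    xs = lookupList n xs
  lookupℤ -[1+ _ ] xs = 0ℚ

  lookupℤ-[] : ∀ t → lookupℤ t [] ≡ 0ℚ
  lookupℤ-[] (+ n)    = lookupList-[] n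
  lookupℤ-[] -[1+ _ ] = refl

  lookupℤ-addList : ∀ t xs ys → lookupℤ t (addList xs ys) ≡ lookupℤ t xs ℚ.+ lookupℤ t ys
  lookupℤ-addList (+ n)    xs ys = lookupList-addList n xs ys
  lookupℤ-addList -[1+ _ ] xs ys = refl

  lookupℤ-map-* : ∀ t c ys → lookupℤ t (map (c ℚ.*_) ys) ≡ c ℚ.* lookupℤ t ys
  lookupℤ-map-* (+ n)    c ys = lookupList-map-* n c ys
  lookupℤ-map-* -[1+ _ ] c ys = ≡.sym (ℚP.*-zeroʳ c)

  lookupℤ-0∷ : ∀ t ys → lookupℤ t (0ℚ ∷ ys) ≡ lookupℤ (t ℤ.- 1ℤ) ys
  lookupℤ-0∷ (+ zero)  ys = refl
  lookupℤ-0∷ (+ suc n) ys = refl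
  lookupℤ-0∷ -[1+ n ]  ys = refl

  [t-1]-x≡t-[1+x] : ∀ t x → (t ℤ.- 1ℤ) ℤ.- x ≡ t ℤ.- (1ℤ ℤ.+ x)
  [t-1]-x≡t-[1+x] = solve-∀

  lookupℤ-pad : ∀ k t xs → lookupℤ t (pad k xs) ≡ lookupℤ (t ℤ.- + k) xs
  lookupℤ-pad zero    t xs = cong (λ s → lookupℤ s xs) (≡.sym (ℤP.+-identityʳ t))
  lookupℤ-pad (suc k) t xs = begin
    lookupℤ t (0ℚ ∷ pad k xs)            ≡⟨ lookupℤ-0∷ t _ ⟩
    lookupℤ (t ℤ.- 1ℤ) (pad k xs)        ≡⟨ lookupℤ-pad k (t ℤ.- 1ℤ) xs ⟩
    lookupℤ (t ℤ.- 1ℤ ℤ.- + k) xs        ≡⟨ cong (λ s → lookupℤ s xs) ([t-1]-x≡t-[1+x] t (+ k)) ⟩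
    lookupℤ (t ℤ.- (1ℤ ℤ.+ + k)) xs      ∎

  lookupℤ-mulList : ∀ t xs ys →
    lookupℤ t (mulList xs ys) ≡ Σ (length xs) (λ a → lookupList a xs ℚ.* lookupℤ (t ℤ.- + a) ys)
  lookupℤ-mulList t []       ys = lookupℤ-[] t
  lookupℤ-mulList t (x ∷ xs) ys = begin
    lookupℤ t (addList (map (x ℚ.*_) ys) (0ℚ ∷ mulList xs ys))
      ≡⟨ lookupℤ-addList t (map (x ℚ.*_) ys) _ ⟩
    lookupℤ t (map (x ℚ.*_) ys) ℚ.+ lookupℤ t (0ℚ ∷ mulList xs ys)
      ≡⟨ cong₂ ℚ._+_ (lookupℤ-map-* t x ys) (≡.trans (lookupℤ-0∷ t _) (lookupℤ-mulList (t ℤ.- 1ℤ) xs ys)) ⟩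
    x ℚ.* lookupℤ t ys ℚ.+ Σ (length xs) (λ a → lookupList a xs ℚ.* lookupℤ (t ℤ.- 1ℤ ℤ.- + a) ys)
      ≡⟨ cong₂ ℚ._+_ (cong (λ s → x ℚ.* lookupℤ s ys) (≡.sym (ℤP.+-identityʳ t)))
                     (ℚΣ.Σ-cong (length xs) (λ a _ →
                        cong (λ s → lookupList a xs ℚ.* lookupℤ s ys) ([t-1]-x≡t-[1+x] t (+ a)))) ⟩
    x ℚ.* lookupℤ (t ℤ.- + 0) ys ℚ.+ Σ (length xs) (λ a → lookupList a xs ℚ.* lookupℤ (t ℤ.- + suc a) ys)
      ≡⟨ ℚΣ.Σ-head (length xs) (λ a → lookupList a (x ∷ xs) ℚ.* lookupℤ (t ℤ.- + a) ys) ⟨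
    Σ (suc (length xs)) (λ a → lookupList a (x ∷ xs) ℚ.* lookupℤ (t ℤ.- + a) ys) ∎

  lookupℤ-cong : ∀ t xs ys → (∀ n → lookupList n xs ≡ lookupList n ys) → lookupℤ t xs ≡ lookupℤ t ys
  lookupℤ-cong (+ n)    xs ys xs≗ys = xs≗ys n
  lookupℤ-cong -[1+ _ ] xs ys xs≗ys = refl

module LaurentCoefficients where
  open ListCoefficients
  open ≡.≡-Reasoning

  coeffU≡lookupℤ : ∀ k p → coeffU k p ≡ lookupℤ (k ℤ.- low p) (cs p)
  coeffU≡lookupℤ k p with k ℤ.- low p
  ... | + n      = refl
  ... | -[1+ _ ] = refl

  coeffU-0L : ∀ k → coeffU k 0L ≡ 0ℚ
  coeffU-0L k = ≡.trans (coeffU≡lookupℤ k 0L) (lookupℤ-[] (k ℤ.- + 0))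

  coeffU-+L : ∀ k p q → coeffU k (p +L q) ≡ coeffU k p ℚ.+ coeffU k q
  coeffU-+L k p q = begin
    coeffU k (p +L q)
      ≡⟨ coeffU≡lookupℤ k (p +L q) ⟩
    lookupℤ (k ℤ.- l) (addList (pad ∣ low p ℤ.- l ∣ (cs p)) (pad ∣ low q ℤ.- l ∣ (cs q)))
      ≡⟨ lookupℤ-addList (k ℤ.- l) _ _ ⟩
    lookupℤ (k ℤ.- l) (pad ∣ low p ℤ.- l ∣ (cs p)) ℚ.+ lookupℤ (k ℤ.- l) (pad ∣ low q ℤ.- l ∣ (cs q))
      ≡⟨ cong₂ ℚ._+_ (unpad p (ℤP.i⊓j≤i (low p) (low q))) (unpad q (ℤP.i⊓j≤j (low p) (low q))) ⟩
    coeffU k p ℚ.+ coeffU k q ∎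
    where
    l = low p ℤ.⊓ low q
    offset : ∀ k l m → l ℤ.≤ m → k ℤ.- l ℤ.- + ∣ m ℤ.- l ∣ ≡ k ℤ.- m
    offset k l m l≤m rewrite ℤP.0≤i⇒+∣i∣≡i (ℤP.i≤j⇒0≤j-i l≤m) = cancel k l m
      where
      cancel : ∀ k l m → k ℤ.- l ℤ.- (m ℤ.- l) ≡ k ℤ.- m
      cancel = solve-∀
    unpad : ∀ r → l ℤ.≤ low r → lookupℤ (k ℤ.- l) (pad ∣ low r ℤ.- l ∣ (cs r)) ≡ coeffU k r
    unpad r l≤r = ≡.trans (lookupℤ-pad _ (k ℤ.- l) (cs r))
      (≡.trans (cong (λ s → lookupℤ s (cs r)) (offset k l (low r) l≤r)) (≡.sym (coeffU≡lookupℤ k r)))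

  coeffU-*L : ∀ k p q →
    coeffU k (p *L q) ≡ Σ (length (cs p)) (λ a → coeffU (low p ℤ.+ + a) p ℚ.* coeffU (k ℤ.- (low p ℤ.+ + a)) q)
  coeffU-*L k p q = begin
    coeffU k (p *L q)
      ≡⟨ coeffU≡lookupℤ k (p *L q) ⟩
    lookupℤ (k ℤ.- (low p ℤ.+ low q)) (mulList (cs p) (cs q))
      ≡⟨ lookupℤ-mulList (k ℤ.- (low p ℤ.+ low q)) (cs p) (cs q) ⟩
    Σ (length (cs p)) (λ a → lookupList a (cs p) ℚ.* lookupℤ (k ℤ.- (low p ℤ.+ low q) ℤ.- + a) (cs q))
      ≡⟨ ℚΣ.Σ-cong (length (cs p)) (λ a _ → cong₂ ℚ._*_ (left a) (right a)) ⟩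
    Σ (length (cs p)) (λ a → coeffU (low p ℤ.+ + a) p ℚ.* coeffU (k ℤ.- (low p ℤ.+ + a)) q) ∎
    where
    l+a-l≡a : ∀ l a → (l ℤ.+ a) ℤ.- l ≡ a
    l+a-l≡a = solve-∀
    regroup : ∀ k l m a → k ℤ.- (l ℤ.+ m) ℤ.- a ≡ (k ℤ.- (l ℤ.+ a)) ℤ.- m
    regroup = solve-∀
    left : ∀ a → lookupList a (cs p) ≡ coeffU (low p ℤ.+ + a) p
    left a = ≡.sym (≡.trans (coeffU≡lookupℤ (low p ℤ.+ + a) p) (cong (λ s → lookupℤ s (cs p)) (l+a-l≡a (low p) (+ a))))
    right : ∀ a → lookupℤ (k ℤ.- (low p ℤ.+ low q) ℤ.- + a) (cs q) ≡ coeffU (k ℤ.- (low p ℤ.+ + a)) q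
    right a = ≡.sym (≡.trans (coeffU≡lookupℤ (k ℤ.- (low p ℤ.+ + a)) q)
                             (cong (λ s → lookupℤ s (cs q)) (≡.sym (regroup k (low p) (low q) (+ a)))))

  coeffU-*L-vanishes : ∀ k p q → (∀ x → coeffU x p ≡ 0ℚ ⊎ coeffU (k ℤ.- x) q ≡ 0ℚ) → coeffU k (p *L q) ≡ 0ℚ
  coeffU-*L-vanishes k p q vanishes =
    ≡.trans (coeffU-*L k p q) (ℚΣ.Σ-zero (length (cs p)) (λ a _ → term (low p ℤ.+ + a)))
    where
    term : ∀ x → coeffU x p ℚ.* coeffU (k ℤ.- x) q ≡ 0ℚ
    term x with vanishes x
    ... | inj₁ p≡0 = ≡.trans (cong (ℚ._* coeffU (k ℤ.- x) q) p≡0) (ℚP.*-zeroˡ (coeffU (k ℤ.- x) q))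
    ... | inj₂ q≡0 = ≡.trans (cong (coeffU x p ℚ.*_) q≡0) (ℚP.*-zeroʳ (coeffU x p))

  coeffU-mono-≢ : ∀ t k c → t ≢ k → coeffU t (mono k c) ≡ 0ℚ
  coeffU-mono-≢ t k c t≢k = ≡.trans (coeffU≡lookupℤ t (mono k c)) (singleton (t ℤ.- k) (t≢k ∘ ℤP.i-j≡0⇒i≡j t k))
    where
    singleton : ∀ s → s ≢ 0ℤ → lookupℤ s (c ∷ []) ≡ 0ℚ
    singleton (+ zero)  s≢0 = ⊥-elim (s≢0 refl)
    singleton (+ suc n) s≢0 = lookupList-[] n
    singleton -[1+ n ]  s≢0 = refl

module LaurentSemiring where
  open ListCoefficients
  open LaurentCoefficients
  open ≡.≡-Reasoning

  infix 4 _≈ᴸ_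
  _≈ᴸ_ : Laurent → Laurent → Set
  p ≈ᴸ q = ∀ k → coeffU k p ≡ coeffU k q

  +L-cong : ∀ {p p′ q q′} → p ≈ᴸ p′ → q ≈ᴸ q′ → p +L q ≈ᴸ p′ +L q′
  +L-cong {p} {p′} {q} {q′} p≈p′ q≈q′ k =
    ≡.trans (coeffU-+L k p q) (≡.trans (cong₂ ℚ._+_ (p≈p′ k) (q≈q′ k)) (≡.sym (coeffU-+L k p′ q′)))

  +L-assoc : ∀ p q r → (p +L q) +L r ≈ᴸ p +L (q +L r)
  +L-assoc p q r k = begin
    coeffU k ((p +L q) +L r)
      ≡⟨ ≡.trans (coeffU-+L k (p +L q) r) (cong (ℚ._+ coeffU k r) (coeffU-+L k p q)) ⟩
    (coeffU k p ℚ.+ coeffU k q) ℚ.+ coeffU k r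
      ≡⟨ ℚP.+-assoc (coeffU k p) (coeffU k q) (coeffU k r) ⟩
    coeffU k p ℚ.+ (coeffU k q ℚ.+ coeffU k r)
      ≡⟨ ≡.trans (coeffU-+L k p (q +L r)) (cong (coeffU k p ℚ.+_) (coeffU-+L k q r)) ⟨
    coeffU k (p +L (q +L r)) ∎

  +L-comm : ∀ p q → p +L q ≈ᴸ q +L p
  +L-comm p q k = ≡.trans (coeffU-+L k p q) (≡.trans (ℚP.+-comm (coeffU k p) (coeffU k q)) (≡.sym (coeffU-+L k q p)))

  +L-identityʳ : ∀ p → p +L 0L ≈ᴸ p
  +L-identityʳ p k = ≡.trans (coeffU-+L k p 0L) (≡.trans (cong (coeffU k p ℚ.+_) (coeffU-0L k)) (ℚP.+-identityʳ (coeffU k p)))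

  *L-comm : ∀ p q → p *L q ≈ᴸ q *L p
  *L-comm p q k = begin
    coeffU k (p *L q)
      ≡⟨ coeffU≡lookupℤ k (p *L q) ⟩
    lookupℤ (k ℤ.- (low p ℤ.+ low q)) (mulList (cs p) (cs q))
      ≡⟨ cong₂ lookupℤ (cong (λ l → k ℤ.- l) (ℤP.+-comm (low p) (low q))) refl ⟩
    lookupℤ (k ℤ.- (low q ℤ.+ low p)) (mulList (cs p) (cs q))
      ≡⟨ lookupℤ-cong (k ℤ.- (low q ℤ.+ low p)) (mulList (cs p) (cs q)) (mulList (cs q) (cs p)) mulList-comm ⟩
    lookupℤ (k ℤ.- (low q ℤ.+ low p)) (mulList (cs q) (cs p))
      ≡⟨ coeffU≡lookupℤ k (q *L p) ⟨
    coeffU k (q *L p) ∎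
    where
    mulList-comm : ∀ n → lookupList n (mulList (cs p) (cs q)) ≡ lookupList n (mulList (cs q) (cs p))
    mulList-comm n = ≡.trans (lookupList-mulList n (cs p) (cs q))
      (≡.trans (ℚ[[y]].⊛-comm (toSeries (cs p)) (toSeries (cs q)) n) (≡.sym (lookupList-mulList n (cs q) (cs p))))

  *L-assoc : ∀ p q r → (p *L q) *L r ≈ᴸ p *L (q *L r)
  *L-assoc p q r k = begin
    coeffU k ((p *L q) *L r)
      ≡⟨ coeffU≡lookupℤ k ((p *L q) *L r) ⟩
    lookupℤ (k ℤ.- ((low p ℤ.+ low q) ℤ.+ low r)) (mulList (mulList xs ys) zs)
      ≡⟨ cong₂ lookupℤ (cong (λ l → k ℤ.- l) (ℤP.+-assoc (low p) (low q) (low r))) refl ⟩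
    lookupℤ (k ℤ.- (low p ℤ.+ (low q ℤ.+ low r))) (mulList (mulList xs ys) zs)
      ≡⟨ lookupℤ-cong (k ℤ.- (low p ℤ.+ (low q ℤ.+ low r))) (mulList (mulList xs ys) zs) (mulList xs (mulList ys zs))
                      mulList-assoc ⟩
    lookupℤ (k ℤ.- (low p ℤ.+ (low q ℤ.+ low r))) (mulList xs (mulList ys zs))
      ≡⟨ coeffU≡lookupℤ k (p *L (q *L r)) ⟨
    coeffU k (p *L (q *L r)) ∎
    where
    xs = cs p
    ys = cs q
    zs = cs r
    open ℚ[[y]] using (_⊛_; ⊛-cong; ⊛-assoc)
    mulList-assoc : ∀ n → lookupList n (mulList (mulList xs ys) zs) ≡ lookupList n (mulList xs (mulList ys zs))
    mulList-assoc n = begin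
      lookupList n (mulList (mulList xs ys) zs)          ≡⟨ lookupList-mulList n (mulList xs ys) zs ⟩
      (toSeries (mulList xs ys) ⊛ toSeries zs) n         ≡⟨ ⊛-cong {g = toSeries zs} (λ i → lookupList-mulList i xs ys)
                                                                       (λ _ → refl) n ⟩
      ((toSeries xs ⊛ toSeries ys) ⊛ toSeries zs) n      ≡⟨ ⊛-assoc (toSeries xs) (toSeries ys) (toSeries zs) n ⟩
      (toSeries xs ⊛ (toSeries ys ⊛ toSeries zs)) n      ≡⟨ ⊛-cong {f = toSeries xs} (λ _ → refl)
                                                                       (λ i → lookupList-mulList i ys zs) n ⟨
      (toSeries xs ⊛ toSeries (mulList ys zs)) n         ≡⟨ lookupList-mulList n xs (mulList ys zs) ⟨
      lookupList n (mulList xs (mulList ys zs))          ∎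

  *L-congʳ : ∀ p {q q′} → q ≈ᴸ q′ → p *L q ≈ᴸ p *L q′
  *L-congʳ p {q} {q′} q≈q′ k = begin
    coeffU k (p *L q)
      ≡⟨ coeffU-*L k p q ⟩
    Σ (length (cs p)) (λ a → coeffU (low p ℤ.+ + a) p ℚ.* coeffU (k ℤ.- (low p ℤ.+ + a)) q)
      ≡⟨ ℚΣ.Σ-cong (length (cs p)) (λ a _ → cong (coeffU (low p ℤ.+ + a) p ℚ.*_)
                                                 (q≈q′ (k ℤ.- (low p ℤ.+ + a)))) ⟩
    Σ (length (cs p)) (λ a → coeffU (low p ℤ.+ + a) p ℚ.* coeffU (k ℤ.- (low p ℤ.+ + a)) q′)
      ≡⟨ coeffU-*L k p q′ ⟨
    coeffU k (p *L q′) ∎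

  *L-cong : ∀ {p p′ q q′} → p ≈ᴸ p′ → q ≈ᴸ q′ → p *L q ≈ᴸ p′ *L q′
  *L-cong {p} {p′} {q} {q′} p≈p′ q≈q′ k =
    ≡.trans (*L-congʳ p q≈q′ k) (≡.trans (*L-comm p q′ k) (≡.trans (*L-congʳ q′ p≈p′ k) (*L-comm q′ p′ k)))

  *L-distribˡ-+L : ∀ p q r → p *L (q +L r) ≈ᴸ (p *L q) +L (p *L r)
  *L-distribˡ-+L p q r k = begin
    coeffU k (p *L (q +L r))
      ≡⟨ coeffU-*L k p (q +L r) ⟩
    Σ n (λ a → c a ℚ.* coeffU (k ℤ.- x a) (q +L r))
      ≡⟨ ℚΣ.Σ-cong n (λ a _ → ≡.trans (cong (c a ℚ.*_) (coeffU-+L (k ℤ.- x a) q r)) (ℚP.*-distribˡ-+ (c a) _ _)) ⟩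
    Σ n (λ a → c a ℚ.* coeffU (k ℤ.- x a) q ℚ.+ c a ℚ.* coeffU (k ℤ.- x a) r)
      ≡⟨ ℚΣ.Σ-distrib-+ n _ _ ⟩
    Σ n (λ a → c a ℚ.* coeffU (k ℤ.- x a) q) ℚ.+ Σ n (λ a → c a ℚ.* coeffU (k ℤ.- x a) r)
      ≡⟨ ≡.trans (coeffU-+L k (p *L q) (p *L r)) (cong₂ ℚ._+_ (coeffU-*L k p q) (coeffU-*L k p r)) ⟨
    coeffU k ((p *L q) +L (p *L r)) ∎
    where
    n = length (cs p)
    x : ℕ → ℤ
    x a = low p ℤ.+ + a
    c : ℕ → ℚ
    c a = coeffU (x a) p

  *L-zeroʳ : ∀ p → p *L 0L ≈ᴸ 0L
  *L-zeroʳ p k = ≡.trans (coeffU-*L-vanishes k p 0L (λ x → inj₂ (coeffU-0L (k ℤ.- x)))) (≡.sym (coeffU-0L k))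

  *L-identityˡ : ∀ p → constL 1ℚ *L p ≈ᴸ p
  *L-identityˡ p k = begin
    coeffU k (constL 1ℚ *L p)           ≡⟨ coeffU-*L k (constL 1ℚ) p ⟩
    0ℚ ℚ.+ 1ℚ ℚ.* coeffU (k ℤ.- + 0) p  ≡⟨ ℚP.+-identityˡ _ ⟩
    1ℚ ℚ.* coeffU (k ℤ.- + 0) p         ≡⟨ ℚP.*-identityˡ _ ⟩
    coeffU (k ℤ.- + 0) p                ≡⟨ cong (λ t → coeffU t p) (ℤP.+-identityʳ k) ⟩
    coeffU k p                          ∎

  commutativeSemiring : CommutativeSemiring _ _
  commutativeSemiring = record
    { Carrier = Laurent ; _≈_ = _≈ᴸ_ ; _+_ = _+L_ ; _*_ = _*L_ ; 0# = 0L ; 1# = constL 1ℚ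
    ; isCommutativeSemiring = isCommutativeSemiringʳ record
      { +-isCommutativeMonoid = isCommutativeMonoidʳ record
        { isSemigroup = record { isMagma = record { isEquivalence = ≈ᴸ-isEquivalence ; ∙-cong = +L-cong } ; assoc = +L-assoc }
        ; identityʳ = +L-identityʳ ; comm = +L-comm }
      ; *-isCommutativeMonoid = isCommutativeMonoidʳ record
        { isSemigroup = record { isMagma = record { isEquivalence = ≈ᴸ-isEquivalence ; ∙-cong = *L-cong } ; assoc = *L-assoc }
        ; identityʳ = λ p k → ≡.trans (*L-comm p (constL 1ℚ) k) (*L-identityˡ p k) ; comm = *L-comm }
      ; distribˡ = *L-distribˡ-+L
      ; zeroʳ = *L-zeroʳ
      }
    }
    where
    ≈ᴸ-isEquivalence : IsEquivalence _≈ᴸ_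
    ≈ᴸ-isEquivalence = record
      { refl = λ k → refl ; sym = λ p≈q k → ≡.sym (p≈q k) ; trans = λ p≈q q≈r k → ≡.trans (p≈q k) (q≈r k) }

module L[[y]] = PowerSeries LaurentSemiring.commutativeSemiring
module LΣ = FiniteSums LaurentSemiring.commutativeSemiring

module ConstL where
  open ListCoefficients
  open LaurentCoefficients
  open LaurentSemiring
  open ≡.≡-Reasoning

  coeffU-constL : ∀ k c → coeffU k (constL c) ≡ lookupℤ k (c ∷ [])
  coeffU-constL k c = ≡.trans (coeffU≡lookupℤ k (constL c)) (cong (λ t → lookupℤ t (c ∷ [])) (ℤP.+-identityʳ k))

  constL-0 : constL 0ℚ ≈ᴸ 0L
  constL-0 k = ≡.trans (coeffU-constL k 0ℚ) (≡.trans (zero-singleton k) (≡.sym (coeffU-0L k)))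
    where
    zero-singleton : ∀ t → lookupℤ t (0ℚ ∷ []) ≡ 0ℚ
    zero-singleton (+ zero)  = refl
    zero-singleton (+ suc n) = lookupList-[] n
    zero-singleton -[1+ n ]  = refl

  constL-+ : ∀ a b → constL (a ℚ.+ b) ≈ᴸ constL a +L constL b
  constL-+ a b k = begin
    coeffU k (constL (a ℚ.+ b))                                ≡⟨ coeffU-constL k (a ℚ.+ b) ⟩
    lookupℤ k (addList (a ∷ []) (b ∷ []))                      ≡⟨ lookupℤ-addList k (a ∷ []) (b ∷ []) ⟩
    lookupℤ k (a ∷ []) ℚ.+ lookupℤ k (b ∷ [])                  ≡⟨ cong₂ ℚ._+_ (coeffU-constL k a) (coeffU-constL k b) ⟨
    coeffU k (constL a) ℚ.+ coeffU k (constL b)                ≡⟨ coeffU-+L k (constL a) (constL b) ⟨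
    coeffU k (constL a +L constL b)                            ∎

  constL-* : ∀ a b → constL (a ℚ.* b) ≈ᴸ constL a *L constL b
  constL-* a b k = begin
    coeffU k (constL (a ℚ.* b))                                ≡⟨ coeffU-constL k (a ℚ.* b) ⟩
    lookupℤ k (map (a ℚ.*_) (b ∷ []))                          ≡⟨ lookupℤ-map-* k a (b ∷ []) ⟩
    a ℚ.* lookupℤ k (b ∷ [])                                   ≡⟨ cong (a ℚ.*_) (coeffU-constL k b) ⟨
    a ℚ.* coeffU k (constL b)                                  ≡⟨ cong (λ t → a ℚ.* coeffU t (constL b)) (ℤP.+-identityʳ k) ⟨
    a ℚ.* coeffU (k ℤ.- + 0) (constL b)                        ≡⟨ ℚP.+-identityˡ _ ⟨
    0ℚ ℚ.+ a ℚ.* coeffU (k ℤ.- + 0) (constL b)                 ≡⟨ coeffU-*L k (constL a) (constL b) ⟨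
    coeffU k (constL a *L constL b)                            ∎

  constL-Σ : ∀ n f → LΣ.Σ n (λ i → constL (f i)) ≈ᴸ constL (Σ n f)
  constL-Σ zero    f = λ k → ≡.sym (constL-0 k)
  constL-Σ (suc n) f k =
    ≡.trans (+L-cong {p′ = constL (Σ n f)} {q′ = constL (f n)} (constL-Σ n f) (λ _ → refl) k)
            (≡.sym (constL-+ (Σ n f) (f n) k))

  constL-⊛ : ∀ f g → (λ i → constL (f i)) L[[y]].⊛ (λ i → constL (g i)) L[[y]].≋ (λ n → constL ((f ℚ[[y]].⊛ g) n))
  constL-⊛ f g n k = ≡.trans
    (LΣ.Σ-cong (suc n) (λ i _ k → ≡.sym (constL-* (f i) (g (n ∸ i)) k)) k)
    (constL-Σ (suc n) (λ i → f i ℚ.* g (n ∸ i)) k)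

module HalfBinomial where
  open ℚ[[y]] using (_⊛_; 1+y)
  open ≡.≡-Reasoning
  open +-*-Solver using (solve; _:=_; _:+_; _:*_; _:-_)

  fromℕ : ℕ → ℚ
  fromℕ k = + k ℚ./ 1

  fromℕ-+ : ∀ a b → fromℕ (a ℕ.+ b) ≡ fromℕ a ℚ.+ fromℕ b
  fromℕ-+ a b = ℚP.toℚᵘ-injective (ℚᵘP.≃-trans (ℚP.toℚᵘ-fromℚᵘ (mkℚᵘ (+ (a ℕ.+ b)) 0))
    (ℚᵘP.≃-sym (ℚᵘP.≃-trans (ℚP.toℚᵘ-homo-+ (fromℕ a) (fromℕ b))
      (ℚᵘP.≃-trans (ℚᵘP.+-cong (ℚP.toℚᵘ-fromℚᵘ (mkℚᵘ (+ a) 0)) (ℚP.toℚᵘ-fromℚᵘ (mkℚᵘ (+ b) 0)))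
                   (*≡* (denominators (+ a) (+ b)))))))
    where
    denominators : ∀ x y → (x ℤ.* 1ℤ ℤ.+ y ℤ.* 1ℤ) ℤ.* 1ℤ ≡ (x ℤ.+ y) ℤ.* 1ℤ
    denominators = solve-∀

  fromℕ-*-inverse : ∀ m → fromℕ (suc m) ℚ.* (+ 1 ℚ./ suc m) ≡ 1ℚ
  fromℕ-*-inverse m = ℚP.toℚᵘ-injective (ℚᵘP.≃-trans (ℚP.toℚᵘ-homo-* (fromℕ (suc m)) (+ 1 ℚ./ suc m))
    (ℚᵘP.≃-trans (ℚᵘP.*-cong (ℚP.toℚᵘ-fromℚᵘ (mkℚᵘ (+ suc m) 0)) (ℚP.toℚᵘ-fromℚᵘ (mkℚᵘ (+ 1) m)))
    (*≡* (denominators (suc m)))))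
    where
    denominators : ∀ n → (+ n ℤ.* 1ℤ) ℤ.* 1ℤ ≡ 1ℤ ℤ.* + (1 ℕ.* n)
    denominators n rewrite ℕP.*-identityˡ n = lemma (+ n)
      where
      lemma : ∀ x → (x ℤ.* 1ℤ) ℤ.* 1ℤ ≡ 1ℤ ℤ.* x
      lemma = solve-∀

  fromℕ-suc-cancel : ∀ m x → fromℕ (suc m) ℚ.* x ≡ 0ℚ → x ≡ 0ℚ
  fromℕ-suc-cancel m x eq = begin
    x                                    ≡⟨ ℚP.*-identityˡ x ⟨
    1ℚ ℚ.* x                             ≡⟨ cong (ℚ._* x) (≡.trans (≡.sym (fromℕ-*-inverse m)) (ℚP.*-comm (fromℕ (suc m)) r)) ⟩
    (r ℚ.* fromℕ (suc m)) ℚ.* x          ≡⟨ ℚP.*-assoc r (fromℕ (suc m)) x ⟩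
    r ℚ.* (fromℕ (suc m) ℚ.* x)          ≡⟨ cong (r ℚ.*_) eq ⟩
    r ℚ.* 0ℚ                             ≡⟨ ℚP.*-zeroʳ r ⟩
    0ℚ                                   ∎
    where r = + 1 ℚ./ suc m

  binomHalf-suc : ∀ k → fromℕ (suc k) ℚ.* binomHalf (suc k) ≡ (½ ℚ.- fromℕ k) ℚ.* binomHalf k
  binomHalf-suc k = begin
    fromℕ (suc k) ℚ.* ((fallHalf k ℚ.* h) ℚ.* (invFact k ℚ.* r))
      ≡⟨ solve 5 (λ x F h I r → x :* ((F :* h) :* (I :* r)) := (h :* (F :* I)) :* (x :* r)) refl
               (fromℕ (suc k)) (fallHalf k) h (invFact k) r ⟩
    (h ℚ.* binomHalf k) ℚ.* (fromℕ (suc k) ℚ.* r)   ≡⟨ cong ((h ℚ.* binomHalf k) ℚ.*_) (fromℕ-*-inverse k) ⟩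
    (h ℚ.* binomHalf k) ℚ.* 1ℚ                      ≡⟨ ℚP.*-identityʳ _ ⟩
    h ℚ.* binomHalf k                               ∎
    where
    h = ½ ℚ.- fromℕ k
    r = + 1 ℚ./ suc k

  private
    b = binomHalf
    c = b ⊛ b
    weighted : ℕ → ℚ
    weighted n = Σ (suc n) (λ i → fromℕ i ℚ.* (b i ℚ.* b (n ∸ i)))

  weighted-symmetric : ∀ n → weighted n ℚ.+ weighted n ≡ fromℕ n ℚ.* c n
  weighted-symmetric n = begin
    weighted n ℚ.+ weighted n
      ≡⟨ cong (weighted n ℚ.+_) (≡.trans (ℚΣ.Σ-reverse (suc n) _)
                                          (ℚΣ.Σ-cong (suc n) (λ i i<1+n → reflect i (ℕP.≤-pred i<1+n)))) ⟩
    weighted n ℚ.+ Σ (suc n) (λ i → fromℕ (n ∸ i) ℚ.* (b (n ∸ i) ℚ.* b i))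
      ≡⟨ ℚΣ.Σ-distrib-+ (suc n) _ _ ⟨
    Σ (suc n) (λ i → fromℕ i ℚ.* (b i ℚ.* b (n ∸ i)) ℚ.+ fromℕ (n ∸ i) ℚ.* (b (n ∸ i) ℚ.* b i))
      ≡⟨ ℚΣ.Σ-cong (suc n) (λ i i<1+n → pair i (ℕP.≤-pred i<1+n)) ⟩
    Σ (suc n) (λ i → fromℕ n ℚ.* (b i ℚ.* b (n ∸ i)))
      ≡⟨ ℚΣ.*-distribˡ-Σ (suc n) (fromℕ n) _ ⟨
    fromℕ n ℚ.* c n ∎
    where
    reflect : ∀ i → i ≤ n →
              fromℕ (n ∸ i) ℚ.* (b (n ∸ i) ℚ.* b (n ∸ (n ∸ i))) ≡ fromℕ (n ∸ i) ℚ.* (b (n ∸ i) ℚ.* b i)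
    reflect i i≤n rewrite ℕP.m∸[m∸n]≡n i≤n = refl
    pair : ∀ i → i ≤ n →
           fromℕ i ℚ.* (b i ℚ.* b (n ∸ i)) ℚ.+ fromℕ (n ∸ i) ℚ.* (b (n ∸ i) ℚ.* b i) ≡ fromℕ n ℚ.* (b i ℚ.* b (n ∸ i))
    pair i i≤n = ≡.trans
      (solve 4 (λ p q x y → p :* (x :* y) :+ q :* (y :* x) := (p :+ q) :* (x :* y)) refl
               (fromℕ i) (fromℕ (n ∸ i)) (b i) (b (n ∸ i)))
      (cong (ℚ._* (b i ℚ.* b (n ∸ i))) (≡.trans (≡.sym (fromℕ-+ i (n ∸ i))) (cong fromℕ (ℕP.m+[n∸m]≡n i≤n))))

  weighted-step : ∀ n → weighted (suc n) ℚ.+ weighted n ≡ ½ ℚ.* c n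
  weighted-step n = begin
    weighted (suc n) ℚ.+ weighted n
      ≡⟨ cong (ℚ._+ weighted n) (ℚΣ.Σ-head (suc n) _) ⟩
    (fromℕ 0 ℚ.* (b 0 ℚ.* b (suc n)) ℚ.+ shifted) ℚ.+ weighted n
      ≡⟨ cong (ℚ._+ weighted n) (≡.trans (cong (ℚ._+ shifted) (ℚP.*-zeroˡ (b 0 ℚ.* b (suc n))))
                                  (≡.trans (ℚP.+-identityˡ shifted) (ℚΣ.Σ-cong (suc n) (λ i _ → lower i)))) ⟩
    Σ (suc n) (λ i → ((½ ℚ.- fromℕ i) ℚ.* b i) ℚ.* b (n ∸ i)) ℚ.+ weighted n
      ≡⟨ ℚΣ.Σ-distrib-+ (suc n) _ _ ⟨
    Σ (suc n) (λ i → ((½ ℚ.- fromℕ i) ℚ.* b i) ℚ.* b (n ∸ i) ℚ.+ fromℕ i ℚ.* (b i ℚ.* b (n ∸ i)))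
      ≡⟨ ℚΣ.Σ-cong (suc n) (λ i _ → solve 4 (λ h a x y → ((h :- a) :* x) :* y :+ a :* (x :* y) := h :* (x :* y))
                                             refl ½ (fromℕ i) (b i) (b (n ∸ i))) ⟩
    Σ (suc n) (λ i → ½ ℚ.* (b i ℚ.* b (n ∸ i)))
      ≡⟨ ℚΣ.*-distribˡ-Σ (suc n) ½ _ ⟨
    ½ ℚ.* c n ∎
    where
    shifted = Σ (suc n) (λ i → fromℕ (suc i) ℚ.* (b (suc i) ℚ.* b (n ∸ i)))
    lower : ∀ i → fromℕ (suc i) ℚ.* (b (suc i) ℚ.* b (n ∸ i)) ≡ ((½ ℚ.- fromℕ i) ℚ.* b i) ℚ.* b (n ∸ i)
    lower i = ≡.trans (≡.sym (ℚP.*-assoc (fromℕ (suc i)) (b (suc i)) (b (n ∸ i)))) (cong (ℚ._* b (n ∸ i)) (binomHalf-suc i))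

  ⊛-recurrence : ∀ n → fromℕ (suc n) ℚ.* c (suc n) ≡ c n ℚ.- fromℕ n ℚ.* c n
  ⊛-recurrence n = begin
    fromℕ (suc n) ℚ.* c (suc n)
      ≡⟨ weighted-symmetric (suc n) ⟨
    w′ ℚ.+ w′
      ≡⟨ solve 2 (λ x y → x :+ x := ((x :+ y) :+ (x :+ y)) :- (y :+ y)) refl w′ (weighted n) ⟩
    ((w′ ℚ.+ weighted n) ℚ.+ (w′ ℚ.+ weighted n)) ℚ.- (weighted n ℚ.+ weighted n)
      ≡⟨ cong₂ ℚ._-_ (cong₂ ℚ._+_ (weighted-step n) (weighted-step n)) (weighted-symmetric n) ⟩
    (½ ℚ.* c n ℚ.+ ½ ℚ.* c n) ℚ.- fromℕ n ℚ.* c n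
      ≡⟨ cong (ℚ._- fromℕ n ℚ.* c n) (≡.trans (≡.sym (ℚP.*-distribʳ-+ (c n) ½ ½)) (ℚP.*-identityˡ (c n))) ⟩
    c n ℚ.- fromℕ n ℚ.* c n ∎
    where w′ = weighted (suc n)

  binomHalf-⊛-binomHalf : ∀ n → (binomHalf ⊛ binomHalf) n ≡ 1+y n
  binomHalf-⊛-binomHalf zero          = refl
  binomHalf-⊛-binomHalf (suc zero)    = refl
  binomHalf-⊛-binomHalf (suc (suc zero))    = fromℕ-suc-cancel 1 (c 2) (⊛-recurrence 1)
  binomHalf-⊛-binomHalf (suc (suc (suc n))) = fromℕ-suc-cancel (suc (suc n)) (c (suc (suc (suc n)))) (begin
    fromℕ (suc (suc (suc n))) ℚ.* c (suc (suc (suc n)))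
      ≡⟨ ⊛-recurrence (suc (suc n)) ⟩
    c (suc (suc n)) ℚ.- fromℕ (suc (suc n)) ℚ.* c (suc (suc n))
      ≡⟨ cong (λ x → x ℚ.- fromℕ (suc (suc n)) ℚ.* x) (binomHalf-⊛-binomHalf (suc (suc n))) ⟩
    0ℚ ℚ.- fromℕ (suc (suc n)) ℚ.* 0ℚ
      ≡⟨ cong (λ x → 0ℚ ℚ.- x) (ℚP.*-zeroʳ (fromℕ (suc (suc n)))) ⟩
    0ℚ ∎)

module Support where
  open LaurentCoefficients
  open LaurentSemiring using (_≈ᴸ_)
  open ListCoefficients using (lookupℤ)
  open ≡.≡-Reasoning

  parityℤ : ℤ → Parity
  parityℤ k = parity ∣ k ∣

  parity-∣⊖∣ : ∀ m n → parity ∣ m ⊖ n ∣ ≡ parity (m ℕ.+ n)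
  parity-∣⊖∣ zero    zero    = refl
  parity-∣⊖∣ zero    (suc n) = refl
  parity-∣⊖∣ (suc m) zero    = cong parity (≡.sym (ℕP.+-identityʳ (suc m)))
  parity-∣⊖∣ (suc m) (suc n) = begin
    parity ∣ suc m ⊖ suc n ∣           ≡⟨ cong (parity ∘ ∣_∣) (ℤP.[1+m]⊖[1+n]≡m⊖n m n) ⟩
    parity ∣ m ⊖ n ∣                   ≡⟨ parity-∣⊖∣ m n ⟩
    parity (suc (suc (m ℕ.+ n)))       ≡⟨ cong (parity ∘ suc) (ℕP.+-suc m n) ⟨
    parity (suc m ℕ.+ suc n)           ∎

  parityℤ-homo-+ : ∀ i j → parityℤ (i ℤ.+ j) ≡ parityℤ i ℙ.+ parityℤ j
  parityℤ-homo-+ i j = ≡.trans (parity-∣+∣ i j) (ℙP.+-homo-+ ∣ i ∣ ∣ j ∣)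
    where
    parity-∣+∣ : ∀ i j → parity ∣ i ℤ.+ j ∣ ≡ parity (∣ i ∣ ℕ.+ ∣ j ∣)
    parity-∣+∣ (+ m)    (+ n)    = refl
    parity-∣+∣ (+ m)    -[1+ n ] = parity-∣⊖∣ m (suc n)
    parity-∣+∣ -[1+ m ] (+ n)    = ≡.trans (parity-∣⊖∣ n (suc m)) (cong parity (ℕP.+-comm n (suc m)))
    parity-∣+∣ -[1+ m ] -[1+ n ] = cong (parity ∘ suc) (≡.sym (ℕP.+-suc m n))

  HasParity : Parity → Laurent → Set
  HasParity π p = ∀ k → parityℤ k ≢ π → coeffU k p ≡ 0ℚ

  HasParity-0L : ∀ π → HasParity π 0L
  HasParity-0L π k _ = coeffU-0L k

  HasParity-+L : ∀ {π p q} → HasParity π p → HasParity π q → HasParity π (p +L q)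
  HasParity-+L {π} {p} {q} πp πq k k≢π =
    ≡.trans (coeffU-+L k p q) (cong₂ ℚ._+_ (πp k k≢π) (πq k k≢π))

  HasParity-*L : ∀ {π ρ p q} → HasParity π p → HasParity ρ q → HasParity (π ℙ.+ ρ) (p *L q)
  HasParity-*L {π} {ρ} {p} {q} πp ρq k k≢π+ρ = coeffU-*L-vanishes k p q vanishes
    where
    vanishes : ∀ x → coeffU x p ≡ 0ℚ ⊎ coeffU (k ℤ.- x) q ≡ 0ℚ
    vanishes x with parityℤ x ℙP.≟ π | parityℤ (k ℤ.- x) ℙP.≟ ρ
    ... | no x≢π | _        = inj₁ (πp x x≢π)
    ... | yes _  | no k-x≢ρ = inj₂ (ρq (k ℤ.- x) k-x≢ρ)
    ... | yes x≡π | yes k-x≡ρ = ⊥-elim (k≢π+ρ (begin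
      parityℤ k                              ≡⟨ cong parityℤ (x+[k-x]≡k x k) ⟨
      parityℤ (x ℤ.+ (k ℤ.- x))              ≡⟨ parityℤ-homo-+ x (k ℤ.- x) ⟩
      parityℤ x ℙ.+ parityℤ (k ℤ.- x)        ≡⟨ cong₂ ℙ._+_ x≡π k-x≡ρ ⟩
      π ℙ.+ ρ                                ∎))
      where
      x+[k-x]≡k : ∀ x k → x ℤ.+ (k ℤ.- x) ≡ k
      x+[k-x]≡k = solve-∀

  HasParity-mono : ∀ k c → HasParity (parityℤ k) (mono k c)
  HasParity-mono k c t t≢k = coeffU-mono-≢ t k c (t≢k ∘ cong parityℤ)

  HasParity-≈ᴸ : ∀ {π p q} → p ≈ᴸ q → HasParity π p → HasParity π q
  HasParity-≈ᴸ p≈q πp k k≢π = ≡.trans (≡.sym (p≈q k)) (πp k k≢π)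

  IsPolynomial : Laurent → Set
  IsPolynomial p = ∀ k → k ℤ.< 0ℤ → coeffU k p ≡ 0ℚ

  IsPolynomial-≈ᴸ : ∀ {p q} → p ≈ᴸ q → IsPolynomial p → IsPolynomial q
  IsPolynomial-≈ᴸ p≈q pp k k<0 = ≡.trans (≡.sym (p≈q k)) (pp k k<0)

  IsPolynomial-0L : IsPolynomial 0L
  IsPolynomial-0L k _ = coeffU-0L k

  IsPolynomial-+L : ∀ {p q} → IsPolynomial p → IsPolynomial q → IsPolynomial (p +L q)
  IsPolynomial-+L {p} {q} pp pq k k<0 = ≡.trans (coeffU-+L k p q) (cong₂ ℚ._+_ (pp k k<0) (pq k k<0))

  IsPolynomial-*L : ∀ {p q} → IsPolynomial p → IsPolynomial q → IsPolynomial (p *L q)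
  IsPolynomial-*L {p} {q} pp pq k k<0 = coeffU-*L-vanishes k p q vanishes
    where
    vanishes : ∀ x → coeffU x p ≡ 0ℚ ⊎ coeffU (k ℤ.- x) q ≡ 0ℚ
    vanishes -[1+ m ] = inj₁ (pp -[1+ m ] ℤ.-<+)
    vanishes (+ a)    = inj₂ (pq (k ℤ.- + a) (ℤP.≤-<-trans (ℤP.i-j≤i k (+ a)) k<0))

  coeffU-even-negative : ∀ {p} j → IsPolynomial p ⊎ HasParity 1ℙ p → coeffU (ℤ.- (+ (2 ℕ.* suc j))) p ≡ 0ℚ
  coeffU-even-negative j (inj₁ polynomial) = polynomial (ℤ.- (+ (2 ℕ.* suc j))) ℤ.-<+
  coeffU-even-negative j (inj₂ odd)        =
    odd (ℤ.- (+ (2 ℕ.* suc j))) (λ even≡odd → 0ℙ≢1ℙ (≡.trans (≡.sym even) even≡odd))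
    where
    0ℙ≢1ℙ : 0ℙ ≢ 1ℙ
    0ℙ≢1ℙ ()
    even : parityℤ (ℤ.- (+ (2 ℕ.* suc j))) ≡ 0ℙ
    even = ≡.trans (cong parity (ℤP.∣-i∣≡∣i∣ (+ (2 ℕ.* suc j)))) (ℙP.*-homo-* 2 (suc j))

  IsPolynomial-laurent : ∀ n xs → IsPolynomial (laurent (+ n) xs)
  IsPolynomial-laurent n xs k k<0 = ≡.trans (coeffU≡lookupℤ k (laurent (+ n) xs))
    (lookupℤ-negative (k ℤ.- + n) (ℤP.≤-<-trans (ℤP.i-j≤i k (+ n)) k<0))
    where
    lookupℤ-negative : ∀ t → t ℤ.< 0ℤ → lookupℤ t xs ≡ 0ℚ
    lookupℤ-negative (+ _)    (ℤ.+<+ ())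
    lookupℤ-negative -[1+ _ ] _          = refl

module SeriesOperations where
  open L[[y]]
  open LaurentSemiring using (commutativeSemiring; *L-congʳ)
  open SetoidReasoning (CommutativeSemiring.setoid ⊕-⊛-commutativeSemiring)

  sumL≡Σ : ∀ n f → sumL n f ≡ LΣ.Σ n f
  sumL≡Σ zero    f = refl
  sumL≡Σ (suc n) f = cong (_+L f n) (sumL≡Σ n f)

  *S≋⊛ : ∀ f g → f *S g ≋ f ⊛ g
  *S≋⊛ f g m k = cong (coeffU k) (sumL≡Σ (suc m) _)

  ^S≋^ : ∀ f n → f ^S n ≋ f ^ n
  ^S≋^ f zero    zero    k = refl
  ^S≋^ f zero    (suc m) k = refl
  ^S≋^ f (suc n) = begin
    (f ^S n) *S f   ≈⟨ *S≋⊛ (f ^S n) f ⟩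
    (f ^S n) ⊛ f    ≈⟨ ⊛-cong {g = f} (^S≋^ f n) (λ _ _ → refl) ⟩
    (f ^ n) ⊛ f     ≈⟨ ⊛-comm (f ^ n) f ⟩
    f ^ suc n       ∎

  constS≋constant : ∀ c → constS c ≋ constant c
  constS≋constant c zero    k = refl
  constS≋constant c (suc m) k = refl

  halfBinomial : Series
  halfBinomial k = constL (binomHalf k)

  sqrt1+≋substitute : ∀ Z → sqrt1+ Z ≋ substitute halfBinomial Z
  sqrt1+≋substitute Z m k = ≡.trans (cong (coeffU k) (sumL≡Σ (suc m) _))
    (LΣ.Σ-cong (suc m) (λ i _ → *L-congʳ (halfBinomial i) (^S≋^ Z i m)) k)

module SquareOfS where
  open L[[y]]
  open LaurentSemiring using (_≈ᴸ_; commutativeSemiring)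
  open Support
  open SeriesOperations
  open ConstL using (constL-0; constL-⊛)
  module L = CommutativeSemiring commutativeSemiring
  module Lₛ = CommutativeSemiring ⊕-⊛-commutativeSemiring
  open SetoidReasoning Lₛ.setoid

  halfBinomial-⊛-halfBinomial : halfBinomial ⊛ halfBinomial ≋ 1+y
  halfBinomial-⊛-halfBinomial n = L.trans (constL-⊛ binomHalf binomHalf n)
    (L.trans (L.reflexive (cong constL (HalfBinomial.binomHalf-⊛-binomHalf n))) (constL-1+y n))
    where
    constL-1+y : ∀ n → constL (ℚ[[y]].1+y n) ≈ᴸ 1+y n
    constL-1+y zero          = L.refl
    constL-1+y (suc zero)    = L.refl
    constL-1+y (suc (suc n)) = constL-0

  u 2u⁻² : Laurent
  u   = mono (+ 1) 1ℚ
  2u⁻² = mono (ℤ.- (+ 2)) (+ 2 ℚ./ 1)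

  E X′ Q S′ : Series
  E  = expS (ℚ.- ½)
  X′ = constant 2u⁻² ⊛ (yS ⊛ T)
  Q  = substitute halfBinomial X′
  S′ = (E ⊛ (yS ⊛ constant u)) ⊛ Q

  X′₀≈0 : X′ 0 ≈ᴸ 0L
  X′₀≈0 = L.trans (L.+-identityˡ _)
    (L.trans (L.*-congˡ {2u⁻²} (L.trans (L.+-identityˡ _) (L.zeroˡ (T 0)))) (L.zeroʳ 2u⁻²))

  S≋S′ : S ≋ S′
  S≋S′ = begin
    (E *S (yS *S constS u)) *S sqrt1+ X   ≈⟨ *S≋⊛ (E *S (yS *S constS u)) (sqrt1+ X) ⟩
    (E *S (yS *S constS u)) ⊛ sqrt1+ X    ≈⟨ ⊛-cong prefix≋ (Lₛ.trans (sqrt1+≋substitute X) (substitute-cong {halfBinomial} Lₛ.refl X≋X′)) ⟩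
    (E ⊛ (yS ⊛ constant u)) ⊛ Q           ∎
    where
    prefix≋ : E *S (yS *S constS u) ≋ E ⊛ (yS ⊛ constant u)
    prefix≋ = Lₛ.trans (*S≋⊛ E (yS *S constS u))
      (⊛-cong {f = E} Lₛ.refl (Lₛ.trans (*S≋⊛ yS (constS u)) (⊛-cong {f = yS} Lₛ.refl (constS≋constant u))))
    X≋X′ : X ≋ X′
    X≋X′ = Lₛ.trans (*S≋⊛ (constS 2u⁻²) (yS *S T)) (⊛-cong (constS≋constant 2u⁻²) (*S≋⊛ yS T))

  Q⊛Q≋1+X′ : Q ⊛ Q ≋ 1ₛ ⊕ X′
  Q⊛Q≋1+X′ = begin
    Q ⊛ Q                               ≈⟨ substitute-⊛ halfBinomial halfBinomial X′ X′₀≈0 ⟩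
    substitute (halfBinomial ⊛ halfBinomial) X′ ≈⟨ substitute-cong {X = X′} halfBinomial-⊛-halfBinomial Lₛ.refl ⟩
    substitute 1+y X′                   ≈⟨ substitute-1+y X′ X′₀≈0 ⟩
    1ₛ ⊕ X′                             ∎

  -- S′ ⊛ S′ = e^{-y} y² (u² + 2yT), with every factor visibly even and polynomial in u.
  W : Series
  W = ((E ⊛ E) ⊛ (yS ⊛ yS)) ⊛ (constant u ⊛ constant u ⊕ constant ((u *L u) *L 2u⁻²) ⊛ (yS ⊛ T))

  S′⊛S′≋W : S′ ⊛ S′ ≋ W
  S′⊛S′≋W = begin
    S′ ⊛ S′
      ≈⟨ square-of-product E yS (constant u) Q ⟩
    (B ⊛ (constant u ⊛ constant u)) ⊛ (Q ⊛ Q)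
      ≈⟨ ⊛-cong {f = B ⊛ (constant u ⊛ constant u)} Lₛ.refl Q⊛Q≋1+X′ ⟩
    (B ⊛ (constant u ⊛ constant u)) ⊛ (1ₛ ⊕ constant 2u⁻² ⊛ (yS ⊛ T))
      ≈⟨ distribute B (constant u) (constant 2u⁻²) (yS ⊛ T) ⟩
    B ⊛ (constant u ⊛ constant u ⊕ ((constant u ⊛ constant u) ⊛ constant 2u⁻²) ⊛ (yS ⊛ T))
      ≈⟨ ⊛-cong {f = B} Lₛ.refl (Lₛ.+-congˡ {constant u ⊛ constant u} (⊛-cong {g = yS ⊛ T} u²2u⁻²≋ Lₛ.refl)) ⟩
    W ∎
    where
    open Rearrangements ⊕-⊛-commutativeSemiring
    B = (E ⊛ E) ⊛ (yS ⊛ yS)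
    u²2u⁻²≋ : (constant u ⊛ constant u) ⊛ constant 2u⁻² ≋ constant ((u *L u) *L 2u⁻²)
    u²2u⁻²≋ = Lₛ.trans (⊛-cong {g = constant 2u⁻²} (constant-* u u) Lₛ.refl) (constant-* (u *L u) 2u⁻²)

  module _ (P : Pred Laurent 0ℓ) (P-0L : P 0L) (P-constL : ∀ c → P (constL c)) where

    expS-coeffwise : ∀ c → Coeffwise P (expS c)
    expS-coeffwise c m = P-constL _

    yS-coeffwise : Coeffwise P yS
    yS-coeffwise zero          = P-0L
    yS-coeffwise (suc zero)    = P-constL 1ℚ
    yS-coeffwise (suc (suc m)) = P-0L

    T-coeffwise : Coeffwise P T
    T-coeffwise m = P-constL _

    halfBinomial-coeffwise : Coeffwise P halfBinomial
    halfBinomial-coeffwise k = P-constL _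

  module OfParity π = Closure (HasParity π) (HasParity-0L π) HasParity-+L
  module Polynomials = Closure IsPolynomial IsPolynomial-0L IsPolynomial-+L

  ⊛-HasParity : ∀ {π ρ f g} → Coeffwise (HasParity π) f → Coeffwise (HasParity ρ) g →
                Coeffwise (HasParity (π ℙ.+ ρ)) (f ⊛ g)
  ⊛-HasParity {π} {ρ} = OfParity.⊛-preserves (π ℙ.+ ρ) {P₁ = HasParity π} {P₂ = HasParity ρ} HasParity-*L

  constL-even : ∀ c → HasParity 0ℙ (constL c)
  constL-even = HasParity-mono (+ 0)

  u-odd : HasParity 1ℙ u
  u-odd = HasParity-mono (+ 1) 1ℚ

  2u⁻²-even : HasParity 0ℙ 2u⁻²
  2u⁻²-even = HasParity-mono (ℤ.- (+ 2)) (+ 2 ℚ./ 1)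

  E-even : Coeffwise (HasParity 0ℙ) E
  E-even = expS-coeffwise (HasParity 0ℙ) (HasParity-0L 0ℙ) constL-even (ℚ.- ½)

  yS-even : Coeffwise (HasParity 0ℙ) yS
  yS-even = yS-coeffwise (HasParity 0ℙ) (HasParity-0L 0ℙ) constL-even

  T-even : Coeffwise (HasParity 0ℙ) T
  T-even = T-coeffwise (HasParity 0ℙ) (HasParity-0L 0ℙ) constL-even

  Q-even : Coeffwise (HasParity 0ℙ) Q
  Q-even = OfParity.substitute-preserves 0ℙ (constL-even 1ℚ) HasParity-*L
    (halfBinomial-coeffwise (HasParity 0ℙ) (HasParity-0L 0ℙ) constL-even)
    (⊛-HasParity (OfParity.constant-preserves 0ℙ 2u⁻²-even) (⊛-HasParity yS-even T-even))

  constant-u-odd : Coeffwise (HasParity 1ℙ) (constant u)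
  constant-u-odd = OfParity.constant-preserves 1ℙ u-odd

  S′-odd : Coeffwise (HasParity 1ℙ) S′
  S′-odd = ⊛-HasParity (⊛-HasParity E-even (⊛-HasParity yS-even constant-u-odd)) Q-even

  W-even : Coeffwise (HasParity 0ℙ) W
  W-even = ⊛-HasParity (⊛-HasParity (⊛-HasParity E-even E-even) (⊛-HasParity yS-even yS-even))
    (OfParity.⊕-preserves 0ℙ (⊛-HasParity constant-u-odd constant-u-odd)
                             (⊛-HasParity (OfParity.constant-preserves 0ℙ u²2u⁻²-even) (⊛-HasParity yS-even T-even)))
    where
    u²2u⁻²-even : HasParity 0ℙ ((u *L u) *L 2u⁻²)
    u²2u⁻²-even = HasParity-*L (HasParity-*L u-odd u-odd) 2u⁻²-even

  ⊛-IsPolynomial : ∀ {f g} → Coeffwise IsPolynomial f → Coeffwise IsPolynomial g →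
                   Coeffwise IsPolynomial (f ⊛ g)
  ⊛-IsPolynomial = Polynomials.⊛-preserves {P₁ = IsPolynomial} {P₂ = IsPolynomial} IsPolynomial-*L

  W-polynomial : Coeffwise IsPolynomial W
  W-polynomial = ⊛-IsPolynomial (⊛-IsPolynomial (⊛-IsPolynomial E-poly E-poly) (⊛-IsPolynomial yS-poly yS-poly))
    (Polynomials.⊕-preserves (⊛-IsPolynomial u-poly u-poly)
                             (⊛-IsPolynomial (Polynomials.constant-preserves (IsPolynomial-laurent 0 _))
                                             (⊛-IsPolynomial yS-poly T-poly)))
    where
    constL-poly : ∀ c → IsPolynomial (constL c)
    constL-poly c = IsPolynomial-laurent 0 (c ∷ [])
    E-poly : Coeffwise IsPolynomial E
    E-poly = expS-coeffwise IsPolynomial IsPolynomial-0L constL-poly (ℚ.- ½)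
    yS-poly : Coeffwise IsPolynomial yS
    yS-poly = yS-coeffwise IsPolynomial IsPolynomial-0L constL-poly
    T-poly : Coeffwise IsPolynomial T
    T-poly = T-coeffwise IsPolynomial IsPolynomial-0L constL-poly
    u-poly : Coeffwise IsPolynomial (constant u)
    u-poly = Polynomials.constant-preserves (IsPolynomial-laurent 1 (1ℚ ∷ []))

  S′^[2+n]≋W⊛S′^n : ∀ n → S′ ^ suc (suc n) ≋ W ⊛ S′ ^ n
  S′^[2+n]≋W⊛S′^n n = begin
    S′ ⊛ (S′ ⊛ S′ ^ n)    ≈⟨ ⊛-assoc S′ S′ (S′ ^ n) ⟨
    (S′ ⊛ S′) ⊛ S′ ^ n    ≈⟨ ⊛-cong {g = S′ ^ n} S′⊛S′≋W Lₛ.refl ⟩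
    W ⊛ S′ ^ n            ∎

  S′^-polynomial-or-odd : ∀ n → Coeffwise IsPolynomial (S′ ^ n) ⊎ Coeffwise (HasParity 1ℙ) (S′ ^ n)
  S′^-polynomial-or-odd zero          = inj₁ (Polynomials.constant-preserves (IsPolynomial-laurent 0 (1ℚ ∷ [])))
  S′^-polynomial-or-odd (suc zero)    = inj₂ (⊛-HasParity S′-odd (OfParity.constant-preserves 0ℙ (constL-even 1ℚ)))
  S′^-polynomial-or-odd (suc (suc n)) = Sum.map polynomial-step odd-step (S′^-polynomial-or-odd n)
    where
    polynomial-step : Coeffwise IsPolynomial (S′ ^ n) → Coeffwise IsPolynomial (S′ ^ suc (suc n))
    polynomial-step polynomial m =
      IsPolynomial-≈ᴸ (Lₛ.sym (S′^[2+n]≋W⊛S′^n n) m) (⊛-IsPolynomial W-polynomial polynomial m)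
    odd-step : Coeffwise (HasParity 1ℙ) (S′ ^ n) → Coeffwise (HasParity 1ℙ) (S′ ^ suc (suc n))
    odd-step odd m = HasParity-≈ᴸ (Lₛ.sym (S′^[2+n]≋W⊛S′^n n) m) (⊛-HasParity W-even odd m)

  S^S≋S′^ : ∀ n → S ^S n ≋ S′ ^ n
  S^S≋S′^ n = Lₛ.trans (^S≋^ S n) (^-congˡ n S≋S′)

lemma2 : (n m j : ℕ) → 1 ≤ j → coeffU (ℤ.- (+ (2 ℕ.* j))) ((S ^S n) m) ≡ 0ℚ
lemma2 n m (suc j) _ = ≡.trans (S^S≋S′^ n m (ℤ.- (+ (2 ℕ.* suc j))))
  (coeffU-even-negative j (Sum.map (λ P → P m) (λ P → P m) (S′^-polynomial-or-odd n)))
  where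
  open Support using (coeffU-even-negative)
  open SquareOfS using (S^S≋S′^; S′^-polynomial-or-odd)
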